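{- For an integer $t \geq 1$ put \[ A=(364t+1)\bigl(16(364t+1)-(364t+5)\bigr),\qquad B=16\bigl(16(364t+5)^2-(364t+1)^2\bigr), \] \[ A'=16(364t+5)^2-(364t+1)^2,\qquad B'=16(364t+5)\bigl(16(364t+1)-(364t+5)\bigr). \] Then for every integer $t\ge1$: (i) $AB(A+B)=A'B'(A'+B')$; (ii) $A^2+AB+B^2\neq A'^2+A'B'+B'^2$; (iii) $\operatorname{ord}_2(B)=4=\operatorname{ord}_2(B')$; (iv) $A\equiv -1\pmod 4$ and $A'\equiv -1 \pmod 4$; (v) $A$ and $B$ are coprime; (vi) $A'$ and $B'$ are coprime; (vii) $AB(A+B)\to\infty$ as $t\to\infty$.
   Context: $\operatorname{ord}_2(n)$ denotes the exponent of $2$ in the prime factorization of the nonzero integer $n$. -}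

module Defs where

open import Data.Nat using (ℕ; suc)
open import Data.Integer using (ℤ; +_; _+_; _-_; _*_; _^_)
open import Data.Integer.Divisibility using (_∣_)
open import Data.Product using (_×_)
open import Relation.Nullary using (¬_)

Ord2 : ℤ → ℕ → Set
Ord2 n k = ((+ 2) ^ k ∣ n) × ¬ ((+ 2) ^ suc k ∣ n)

aₜ : ℤ → ℤ
aₜ t = + 364 * t + + 1

bₜ : ℤ → ℤ
bₜ t = + 364 * t + + 5

A : ℤ → ℤ
A t = aₜ t * (+ 16 * aₜ t - bₜ t)

B : ℤ → ℤ
B t = + 16 * (+ 16 * bₜ t ^ 2 - aₜ t ^ 2)

A′ : ℤ → ℤ
A′ t = + 16 * bₜ t ^ 2 - aₜ t ^ 2

B′ : ℤ → ℤ
B′ t = + 16 * bₜ t * (+ 16 * aₜ t - bₜ t)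

{-# OPTIONS --safe #-}
-- Write a = 364t + 1, b = 364t + 5, c = 16a − b and d = 16b² − a², so that A = ac, B = 16d,
-- A′ = d and B′ = 16bc.  Then (i) is the identity a(ac + 16d) = b(d + 16bc), which holds because
-- c(a² − 16b²) = −cd = −d(16a − b).  As a ≡ 1 and b ≡ 5 modulo 364 = 4 · 7 · 13, the residues
-- of A, B, A′, B′ modulo 2, 4 and 7 do not depend on t: d and bc are odd, which gives (iii),
-- A ≡ A′ ≡ −1 (mod 4), and the two quadratic forms differ modulo 7, which gives (ii).  For (v)
-- and (vi) it suffices that a, b, c, d are odd and each of a, b, c is coprime to d: modulo a,
-- d ≡ 16b²; modulo b, d ≡ −a²; modulo c, 256d ≡ 4095b², where c = 5460t + 11 is prime to 4095
-- and gcd(b, c) = gcd(b, 16a) = 1 (a and b are coprime because b − a = 4).  Finally, for t ≥ 0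
-- all these factors are positive and AB(A + B) ≥ A ≥ a > t.
module Submission where

open import Defs
open import Data.Nat using (ℕ)
open import Data.Integer using (ℤ; +_; _+_; _*_; _≤_; _<_)
open import Data.Integer.Divisibility using (_∣_)
open import Data.Integer.Coprimality using (Coprime)
open import Data.Product using (_×_; ∃-syntax)
open import Relation.Binary.PropositionalEquality using (_≡_; _≢_)

open import Data.Nat as ℕ using (suc)
import Data.Nat.Properties as ℕ
import Data.Nat.Divisibility as ℕ
import Data.Nat.Coprimality as ℕ
open import Data.Integer using (∣_∣; -_; _-_; _^_; _⊔_; -1ℤ; +≤+; +<+; NonZero; ≢-nonZero)
import Data.Integer.Properties as ℤ
open import Data.Integer.Divisibility.Signed as Signed
  using (divides; _∣?_; ∣ᵤ⇒∣; ∣⇒∣ᵤ)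
  renaming (_∣_ to _∣ₛ_)
import Data.Integer.Coprimality as ℤ-Coprime
open import Data.Integer.Tactic.RingSolver using (solve-∀)
open import Data.Integer.Solver using (module +-*-Solver)
open +-*-Solver using (solve; _:=_; con; _:+_; _:-_; :-_; _:*_; _:^_)
open import Data.Product using (_,_)
open import Relation.Nullary using (Dec; ¬_; contradiction)
import Relation.Nullary.Decidable as Dec
open import Relation.Nullary.Decidable using (from-yes; from-no)
open import Relation.Binary.PropositionalEquality
  using (refl; sym; trans; cong; cong₂; subst; module ≡-Reasoning)

infix 4 _≡_[mod_] _≟_[mod_]

record _≡_[mod_] (x y m : ℤ) : Set where
  constructor ≡-mod
  field m∣x-y : m ∣ₛ x - y

open _≡_[mod_]

_≟_[mod_] : ∀ x y m → Dec (x ≡ y [mod m ])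
x ≟ y [mod m ] = Dec.map′ ≡-mod m∣x-y (m ∣? x - y)

module _ {m : ℤ} where

  ≡-mod-refl : ∀ {x} → x ≡ x [mod m ]
  ≡-mod-refl {x} = ≡-mod (divides (+ 0) (ℤ.+-inverseʳ x))

  ≡-mod-sym : ∀ {x y} → x ≡ y [mod m ] → y ≡ x [mod m ]
  ≡-mod-sym {x} {y} (≡-mod m∣x-y) = ≡-mod (subst (m ∣ₛ_) (identity x y) (Signed.∣m⇒∣-m m∣x-y))
    where
    identity : ∀ x y → - (x - y) ≡ y - x
    identity = solve-∀

  ≡-mod-trans : ∀ {x y z} → x ≡ y [mod m ] → y ≡ z [mod m ] → x ≡ z [mod m ]
  ≡-mod-trans {x} {y} {z} (≡-mod m∣x-y) (≡-mod m∣y-z) =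
    ≡-mod (subst (m ∣ₛ_) (identity x y z) (Signed.∣m∣n⇒∣m+n m∣x-y m∣y-z))
    where
    identity : ∀ x y z → (x - y) + (y - z) ≡ x - z
    identity = solve-∀

  ≡-mod-+ : ∀ {x x′ y y′} → x ≡ x′ [mod m ] → y ≡ y′ [mod m ] → x + y ≡ x′ + y′ [mod m ]
  ≡-mod-+ {x} {x′} {y} {y′} (≡-mod m∣x-x′) (≡-mod m∣y-y′) =
    ≡-mod (subst (m ∣ₛ_) (identity x x′ y y′) (Signed.∣m∣n⇒∣m+n m∣x-x′ m∣y-y′))
    where
    identity : ∀ x x′ y y′ → (x - x′) + (y - y′) ≡ x + y - (x′ + y′)
    identity = solve-∀

  ≡-mod-- : ∀ {x x′ y y′} → x ≡ x′ [mod m ] → y ≡ y′ [mod m ] → x - y ≡ x′ - y′ [mod m ]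
  ≡-mod-- {x} {x′} {y} {y′} (≡-mod m∣x-x′) (≡-mod m∣y-y′) =
    ≡-mod (subst (m ∣ₛ_) (identity x x′ y y′) (Signed.∣m∣n⇒∣m-n m∣x-x′ m∣y-y′))
    where
    identity : ∀ x x′ y y′ → (x - x′) - (y - y′) ≡ x - y - (x′ - y′)
    identity = solve-∀

  ≡-mod-* : ∀ {x x′ y y′} → x ≡ x′ [mod m ] → y ≡ y′ [mod m ] → x * y ≡ x′ * y′ [mod m ]
  ≡-mod-* {x} {x′} {y} {y′} (≡-mod m∣x-x′) (≡-mod m∣y-y′) =
    ≡-mod (subst (m ∣ₛ_) (identity x x′ y y′)
      (Signed.∣m∣n⇒∣m+n (Signed.∣n⇒∣m*n y m∣x-x′) (Signed.∣n⇒∣m*n x′ m∣y-y′)))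
    where
    identity : ∀ x x′ y y′ → y * (x - x′) + x′ * (y - y′) ≡ x * y - x′ * y′
    identity = solve-∀

  ≡-mod-^ : ∀ {x y} → x ≡ y [mod m ] → ∀ n → x ^ n ≡ y ^ n [mod m ]
  ≡-mod-^ x≡y ℕ.zero  = ≡-mod-refl
  ≡-mod-^ x≡y (suc n) = ≡-mod-* x≡y (≡-mod-^ x≡y n)

  ≡-mod-∣ : ∀ {n x y} → n ∣ₛ m → x ≡ y [mod m ] → x ≡ y [mod n ]
  ≡-mod-∣ n∣m (≡-mod m∣x-y) = ≡-mod (Signed.∣-trans n∣m m∣x-y)

  ∣-resp-≡-mod : ∀ {n x y} → n ∣ₛ m → x ≡ y [mod m ] → n ∣ₛ y → n ∣ₛ x
  ∣-resp-≡-mod {n} {x} {y} n∣m x≡y n∣y =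
    subst (n ∣ₛ_) (identity x y) (Signed.∣m∣n⇒∣m+n (m∣x-y (≡-mod-∣ n∣m x≡y)) n∣y)
    where
    identity : ∀ x y → (x - y) + y ≡ x
    identity = solve-∀

coprime-1 : ∀ m → Coprime m (+ 1)
coprime-1 m = ℕ.sym (ℕ.1-coprimeTo ∣ m ∣)

coprime-*ʳ : ∀ m x y → Coprime m x → Coprime m y → Coprime m (x * y)
coprime-*ʳ m x y m⊥x m⊥y {d} (d∣m , d∣xy) = m⊥y (d∣m , d∣y)
  where
  d⊥x : ℕ.Coprime d ∣ x ∣
  d⊥x (e∣d , e∣x) = m⊥x (ℕ.∣-trans e∣d d∣m , e∣x)
  d∣y : d ℕ.∣ ∣ y ∣
  d∣y = ℕ.coprime-divisor d⊥x (subst (d ℕ.∣_) (ℤ.abs-* x y) d∣xy)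

coprime-*ˡ : ∀ m x y → Coprime x m → Coprime y m → Coprime (x * y) m
coprime-*ˡ m x y x⊥m y⊥m =
  ℤ-Coprime.sym {m} {x * y}
    (coprime-*ʳ m x y (ℤ-Coprime.sym {x} {m} x⊥m) (ℤ-Coprime.sym {y} {m} y⊥m))

coprime-^ : ∀ m x → Coprime m x → ∀ n → Coprime m (x ^ n)
coprime-^ m x m⊥x ℕ.zero  = coprime-1 m
coprime-^ m x m⊥x (suc n) = coprime-*ʳ m x (x ^ n) m⊥x (coprime-^ m x m⊥x n)

coprime-*⇒coprime : ∀ m k x → Coprime m (k * x) → Coprime m x
coprime-*⇒coprime m k x m⊥kx {d} (d∣m , d∣x) =
  m⊥kx (d∣m , subst (d ℕ.∣_) (sym (ℤ.abs-* k x)) (ℕ.∣n⇒∣m*n ∣ k ∣ d∣x))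

coprime-≡-mod : ∀ {m x y} → x ≡ y [mod m ] → Coprime m y → Coprime m x
coprime-≡-mod x≡y m⊥y {d} (d∣m , d∣x) =
  m⊥y (d∣m , ∣⇒∣ᵤ (∣-resp-≡-mod (∣ᵤ⇒∣ {+ d} d∣m) (≡-mod-sym x≡y) (∣ᵤ⇒∣ {+ d} d∣x)))

odd⇒coprime-2^ : ∀ {x} → x ≡ + 1 [mod + 2 ] → ∀ k → Coprime x ((+ 2) ^ k)
odd⇒coprime-2^ {x} x-odd =
  coprime-^ x (+ 2) (ℤ-Coprime.sym {+ 2} {x} (coprime-≡-mod x-odd (coprime-1 (+ 2))))

ord₂-2^k*odd : ∀ k {x} → x ≡ + 1 [mod + 2 ] → Ord2 ((+ 2) ^ k * x) k
ord₂-2^k*odd k {x} x-odd = ∣⇒∣ᵤ (Signed.∣m⇒∣m*n x (Signed.∣-refl {(+ 2) ^ k})) , 2^[1+k]∤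
  where
  instance
    2^k≢0 : NonZero ((+ 2) ^ k)
    2^k≢0 = ≢-nonZero (λ 2^k≡0 → contradiction (ℤ.i^n≡0⇒i≡0 (+ 2) k 2^k≡0) λ ())
  2^[1+k]∤ : ¬ ((+ 2) ^ suc k ∣ (+ 2) ^ k * x)
  2^[1+k]∤ 2^[1+k]∣ = from-no (+ 2 ∣? + 1) (∣-resp-≡-mod Signed.∣-refl (≡-mod-sym x-odd) 2∣x)
    where
    2∣x : + 2 ∣ₛ x
    2∣x = Signed.*-cancelˡ-∣ ((+ 2) ^ k)
      (subst (_∣ₛ (+ 2) ^ k * x) (ℤ.*-comm (+ 2) ((+ 2) ^ k)) (∣ᵤ⇒∣ 2^[1+k]∣))

c[_,_] d[_,_] A[_,_] B[_,_] A′[_,_] B′[_,_] : ℤ → ℤ → ℤ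
c[ a , b ] = + 16 * a - b
d[ a , b ] = + 16 * b ^ 2 - a ^ 2
A[ a , b ] = a * c[ a , b ]
B[ a , b ] = + 16 * d[ a , b ]
A′[ a , b ] = d[ a , b ]
B′[ a , b ] = + 16 * b * c[ a , b ]

A-B-identity : ∀ a b → A[ a , b ] * B[ a , b ] * (A[ a , b ] + B[ a , b ])
                     ≡ A′[ a , b ] * B′[ a , b ] * (A′[ a , b ] + B′[ a , b ])
A-B-identity = solve 2 (λ a b →
  let c = con (+ 16) :* a :- b
      d = con (+ 16) :* b :^ 2 :- a :^ 2
  in  a :* c :* (con (+ 16) :* d) :* (a :* c :+ con (+ 16) :* d)
   := d :* (con (+ 16) :* b :* c) :* (d :+ con (+ 16) :* b :* c)) refl

module _ {m a b a₀ b₀ : ℤ} (a≡a₀ : a ≡ a₀ [mod m ]) (b≡b₀ : b ≡ b₀ [mod m ]) where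

  c-≡-mod : c[ a , b ] ≡ c[ a₀ , b₀ ] [mod m ]
  c-≡-mod = ≡-mod-- (≡-mod-* (≡-mod-refl {x = + 16}) a≡a₀) b≡b₀

  d-≡-mod : d[ a , b ] ≡ d[ a₀ , b₀ ] [mod m ]
  d-≡-mod = ≡-mod-- (≡-mod-* (≡-mod-refl {x = + 16}) (≡-mod-^ b≡b₀ 2)) (≡-mod-^ a≡a₀ 2)

  A-≡-mod : A[ a , b ] ≡ A[ a₀ , b₀ ] [mod m ]
  A-≡-mod = ≡-mod-* a≡a₀ c-≡-mod

  B-≡-mod : B[ a , b ] ≡ B[ a₀ , b₀ ] [mod m ]
  B-≡-mod = ≡-mod-* (≡-mod-refl {x = + 16}) d-≡-mod

  A′-≡-mod : A′[ a , b ] ≡ A′[ a₀ , b₀ ] [mod m ]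
  A′-≡-mod = d-≡-mod

  B′-≡-mod : B′[ a , b ] ≡ B′[ a₀ , b₀ ] [mod m ]
  B′-≡-mod = ≡-mod-* (≡-mod-* (≡-mod-refl {x = + 16}) b≡b₀) c-≡-mod

module _ {a b : ℤ} (a-odd : a ≡ + 1 [mod + 2 ]) (b-odd : b ≡ + 1 [mod + 2 ]) where

  private
    c = c[ a , b ]
    d = d[ a , b ]

  c-odd : c ≡ + 1 [mod + 2 ]
  c-odd = ≡-mod-trans (c-≡-mod a-odd b-odd) (from-yes (+ 15 ≟ + 1 [mod + 2 ]))

  d-odd : d ≡ + 1 [mod + 2 ]
  d-odd = ≡-mod-trans (d-≡-mod a-odd b-odd) (from-yes (+ 15 ≟ + 1 [mod + 2 ]))

  B-ord₂ : Ord2 B[ a , b ] 4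
  B-ord₂ = ord₂-2^k*odd 4 d-odd

  B′-ord₂ : Ord2 B′[ a , b ] 4
  B′-ord₂ = subst (λ x → Ord2 x 4) (sym (ℤ.*-assoc (+ 16) b c))
    (ord₂-2^k*odd 4 (≡-mod-* b-odd c-odd))

  module _ (a⊥b : Coprime a b) (c⊥4095 : Coprime c (+ 4095)) where

    private
      b⊥a : Coprime b a
      b⊥a = ℤ-Coprime.sym {a} {b} a⊥b

    a⊥d : Coprime a d
    a⊥d = coprime-≡-mod d≡16b²
      (coprime-*ʳ a (+ 16) (b ^ 2) (odd⇒coprime-2^ a-odd 4) (coprime-^ a b a⊥b 2))
      where
      d≡16b² : d ≡ + 16 * b ^ 2 [mod a ]
      d≡16b² = ≡-mod (divides (- a) (solve 2 (λ a b →
        con (+ 16) :* b :^ 2 :- a :^ 2 :- con (+ 16) :* b :^ 2 := :- a :* a) refl a b))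

    -- As ∣ -1 ∣ = 1, coprime-1 b is also a proof of Coprime b -1ℤ.
    b⊥d : Coprime b d
    b⊥d = coprime-≡-mod d≡-a² (coprime-*ʳ b -1ℤ (a ^ 2) (coprime-1 b) (coprime-^ b a b⊥a 2))
      where
      d≡-a² : d ≡ -1ℤ * a ^ 2 [mod b ]
      d≡-a² = ≡-mod (divides (+ 16 * b) (solve 2 (λ a b →
        con (+ 16) :* b :^ 2 :- a :^ 2 :- con -1ℤ :* a :^ 2 := con (+ 16) :* b :* b) refl a b))

    b⊥c : Coprime b c
    b⊥c = coprime-≡-mod c≡16a (coprime-*ʳ b (+ 16) a (odd⇒coprime-2^ b-odd 4) b⊥a)
      where
      c≡16a : c ≡ + 16 * a [mod b ]
      c≡16a = ≡-mod (divides -1ℤ (solve 2 (λ a b →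
        con (+ 16) :* a :- b :- con (+ 16) :* a := con -1ℤ :* b) refl a b))

    c⊥d : Coprime c d
    c⊥d = coprime-*⇒coprime c (+ 256) d (coprime-≡-mod 256d≡4095b²
      (coprime-*ʳ c (+ 4095) (b ^ 2) c⊥4095 (coprime-^ c b (ℤ-Coprime.sym {b} {c} b⊥c) 2)))
      where
      256d≡4095b² : + 256 * d ≡ + 4095 * b ^ 2 [mod c ]
      256d≡4095b² = ≡-mod (divides (- (+ 2 * b + c)) (solve 2 (λ a b →
        let c = con (+ 16) :* a :- b
        in  con (+ 256) :* (con (+ 16) :* b :^ 2 :- a :^ 2) :- con (+ 4095) :* b :^ 2
         := :- (con (+ 2) :* b :+ c) :* c) refl a b))

    A⊥B : Coprime A[ a , b ] B[ a , b ]
    A⊥B = coprime-*ˡ B[ a , b ] a c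
      (coprime-*ʳ a (+ 16) d (odd⇒coprime-2^ a-odd 4) a⊥d)
      (coprime-*ʳ c (+ 16) d (odd⇒coprime-2^ c-odd 4) c⊥d)

    A′⊥B′ : Coprime A′[ a , b ] B′[ a , b ]
    A′⊥B′ = coprime-*ʳ d (+ 16 * b) c
      (coprime-*ʳ d (+ 16) b (odd⇒coprime-2^ d-odd 4) (ℤ-Coprime.sym {b} {d} b⊥d))
      (ℤ-Coprime.sym {c} {d} c⊥d)

norm : ℤ → ℤ → ℤ
norm x y = x * x + x * y + y * y

≡-mod-norm : ∀ {m x x₀ y y₀} → x ≡ x₀ [mod m ] → y ≡ y₀ [mod m ] → norm x y ≡ norm x₀ y₀ [mod m ]
≡-mod-norm x≡x₀ y≡y₀ = ≡-mod-+ (≡-mod-+ (≡-mod-* x≡x₀ x≡x₀) (≡-mod-* x≡x₀ y≡y₀)) (≡-mod-* y≡y₀ y≡y₀)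

-- Modulo 7, (A, B, A′, B′) ≡ (4, 0, 0, 5), so the two norms are 2 and 4.
norm-A-B≢norm-A′-B′ : ∀ {a b} → a ≡ + 1 [mod + 7 ] → b ≡ + 5 [mod + 7 ] →
                      norm A[ a , b ] B[ a , b ] ≢ norm A′[ a , b ] B′[ a , b ]
norm-A-B≢norm-A′-B′ {a} {b} a≡1 b≡5 eq =
  from-no (+ 2 ≟ + 4 [mod + 7 ])
    (≡-mod-trans (≡-mod-sym norm-A-B≡2) (subst (_≡ + 4 [mod + 7 ]) (sym eq) norm-A′-B′≡4))
  where
  norm-A-B≡2 : norm A[ a , b ] B[ a , b ] ≡ + 2 [mod + 7 ]
  norm-A-B≡2 = ≡-mod-trans (≡-mod-norm (A-≡-mod a≡1 b≡5) (B-≡-mod a≡1 b≡5))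
    (from-yes (norm A[ + 1 , + 5 ] B[ + 1 , + 5 ] ≟ + 2 [mod + 7 ]))
  norm-A′-B′≡4 : norm A′[ a , b ] B′[ a , b ] ≡ + 4 [mod + 7 ]
  norm-A′-B′≡4 = ≡-mod-trans (≡-mod-norm (A′-≡-mod a≡1 b≡5) (B′-≡-mod a≡1 b≡5))
    (from-yes (norm A′[ + 1 , + 5 ] B′[ + 1 , + 5 ] ≟ + 4 [mod + 7 ]))

module _ {a b : ℤ} (a≡1 : a ≡ + 1 [mod + 4 ]) (b≡1 : b ≡ + 1 [mod + 4 ]) where

  4∣A+1 : + 4 ∣ A[ a , b ] + + 1
  4∣A+1 = ∣⇒∣ᵤ (m∣x-y (≡-mod-trans (A-≡-mod a≡1 b≡1) (from-yes (+ 15 ≟ -1ℤ [mod + 4 ]))))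

  4∣A′+1 : + 4 ∣ A′[ a , b ] + + 1
  4∣A′+1 = ∣⇒∣ᵤ (m∣x-y (≡-mod-trans (A′-≡-mod a≡1 b≡1) (from-yes (+ 15 ≟ -1ℤ [mod + 4 ]))))

module _ (t : ℤ) where

  private
    c = c[ aₜ t , bₜ t ]

  aₜ≡1 : ∀ n → n ∣ₛ + 364 → aₜ t ≡ + 1 [mod n ]
  aₜ≡1 n n∣364 = ≡-mod-∣ n∣364 (≡-mod (divides t (solve 1 (λ t →
    con (+ 364) :* t :+ con (+ 1) :- con (+ 1) := t :* con (+ 364)) refl t)))

  bₜ≡5 : ∀ n → n ∣ₛ + 364 → bₜ t ≡ + 5 [mod n ]
  bₜ≡5 n n∣364 = ≡-mod-∣ n∣364 (≡-mod (divides t (solve 1 (λ t →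
    con (+ 364) :* t :+ con (+ 5) :- con (+ 5) := t :* con (+ 364)) refl t)))

  aₜ-odd : aₜ t ≡ + 1 [mod + 2 ]
  aₜ-odd = aₜ≡1 (+ 2) (divides (+ 182) refl)

  bₜ-odd : bₜ t ≡ + 1 [mod + 2 ]
  bₜ-odd = ≡-mod-trans (bₜ≡5 (+ 2) (divides (+ 182) refl)) (from-yes (+ 5 ≟ + 1 [mod + 2 ]))

  aₜ≡1[mod4] : aₜ t ≡ + 1 [mod + 4 ]
  aₜ≡1[mod4] = aₜ≡1 (+ 4) (divides (+ 91) refl)

  bₜ≡1[mod4] : bₜ t ≡ + 1 [mod + 4 ]
  bₜ≡1[mod4] = ≡-mod-trans (bₜ≡5 (+ 4) (divides (+ 91) refl)) (from-yes (+ 5 ≟ + 1 [mod + 4 ]))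

  aₜ≡1[mod7] : aₜ t ≡ + 1 [mod + 7 ]
  aₜ≡1[mod7] = aₜ≡1 (+ 7) (divides (+ 52) refl)

  bₜ≡5[mod7] : bₜ t ≡ + 5 [mod + 7 ]
  bₜ≡5[mod7] = bₜ≡5 (+ 7) (divides (+ 52) refl)

  aₜ⊥bₜ : Coprime (aₜ t) (bₜ t)
  aₜ⊥bₜ = coprime-≡-mod bₜ≡4 (ℤ-Coprime.sym {+ 4} {aₜ t} (coprime-≡-mod aₜ≡1[mod4] (coprime-1 (+ 4))))
    where
    bₜ≡4 : bₜ t ≡ + 4 [mod aₜ t ]
    bₜ≡4 = ≡-mod (divides (+ 1) (solve 1 (λ t →
      con (+ 364) :* t :+ con (+ 5) :- con (+ 4)
      := con (+ 1) :* (con (+ 364) :* t :+ con (+ 1))) refl t))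

  -- c = 5460 t + 11, and both factors of 4095 = 3 · 1365 divide 5460.
  cₜ⊥4095 : Coprime c (+ 4095)
  cₜ⊥4095 = coprime-*ʳ c (+ 3) (+ 1365)
    (c⊥ (+ 3) (divides (+ 1820) refl) (from-yes (ℤ-Coprime.coprime? (+ 3) (+ 11))))
    (c⊥ (+ 1365) (divides (+ 4) refl) (from-yes (ℤ-Coprime.coprime? (+ 1365) (+ 11))))
    where
    c≡11 : c ≡ + 11 [mod + 5460 ]
    c≡11 = ≡-mod (divides t (solve 1 (λ t →
      con (+ 16) :* (con (+ 364) :* t :+ con (+ 1)) :- (con (+ 364) :* t :+ con (+ 5)) :- con (+ 11)
      := t :* con (+ 5460)) refl t))
    c⊥ : ∀ n → n ∣ₛ + 5460 → Coprime n (+ 11) → Coprime c n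
    c⊥ n n∣5460 n⊥11 = ℤ-Coprime.sym {n} {c} (coprime-≡-mod (≡-mod-∣ n∣5460 c≡11) n⊥11)

pos-affine : ∀ r k n → + r + + k * + n ≡ + (r ℕ.+ k ℕ.* n)
pos-affine r k n = cong (λ x → + r + x) (sym (ℤ.pos-* k n))

A-on-ℕ : ∀ n → A (+ n) ≡ + ((1 ℕ.+ 364 ℕ.* n) ℕ.* (11 ℕ.+ 5460 ℕ.* n))
A-on-ℕ n = begin
  A (+ n)
    ≡⟨ A-factorised (+ n) ⟩
  (+ 1 + + 364 * + n) * (+ 11 + + 5460 * + n)
    ≡⟨ cong₂ _*_ (pos-affine 1 364 n) (pos-affine 11 5460 n) ⟩
  + ((1 ℕ.+ 364 ℕ.* n) ℕ.* (11 ℕ.+ 5460 ℕ.* n))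
    ∎
  where
  open ≡-Reasoning
  A-factorised : ∀ t → A t ≡ (+ 1 + + 364 * t) * (+ 11 + + 5460 * t)
  A-factorised = solve 1 (λ t →
    let a = con (+ 364) :* t :+ con (+ 1)
        b = con (+ 364) :* t :+ con (+ 5)
    in  a :* (con (+ 16) :* a :- b)
     := (con (+ 1) :+ con (+ 364) :* t) :* (con (+ 11) :+ con (+ 5460) :* t)) refl

B-on-ℕ : ∀ n → B (+ n) ≡ + (16 ℕ.* ((19 ℕ.+ 1092 ℕ.* n) ℕ.* (21 ℕ.+ 1820 ℕ.* n)))
B-on-ℕ n = begin
  B (+ n)
    ≡⟨ B-factorised (+ n) ⟩
  + 16 * ((+ 19 + + 1092 * + n) * (+ 21 + + 1820 * + n))
    ≡⟨ cong (λ x → + 16 * x) (cong₂ _*_ (pos-affine 19 1092 n) (pos-affine 21 1820 n)) ⟩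
  + (16 ℕ.* ((19 ℕ.+ 1092 ℕ.* n) ℕ.* (21 ℕ.+ 1820 ℕ.* n)))
    ∎
  where
  open ≡-Reasoning
  B-factorised : ∀ t → B t ≡ + 16 * ((+ 19 + + 1092 * t) * (+ 21 + + 1820 * t))
  B-factorised = solve 1 (λ t →
    let a = con (+ 364) :* t :+ con (+ 1)
        b = con (+ 364) :* t :+ con (+ 5)
    in  con (+ 16) :* (con (+ 16) :* b :^ 2 :- a :^ 2)
     := con (+ 16) :* ((con (+ 19) :+ con (+ 1092) :* t) :* (con (+ 21) :+ con (+ 1820) :* t))) refl

x*y*[x+y]-on-ℕ : ∀ x y → + x * + y * (+ x + + y) ≡ + (x ℕ.* y ℕ.* (x ℕ.+ y))
x*y*[x+y]-on-ℕ x y = begin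
  + x * + y * (+ x + + y)      ≡⟨ cong₂ _*_ (sym (ℤ.pos-* x y)) (sym (ℤ.pos-+ x y)) ⟩
  + (x ℕ.* y) * + (x ℕ.+ y)    ≡⟨ sym (ℤ.pos-* (x ℕ.* y) (x ℕ.+ y)) ⟩
  + (x ℕ.* y ℕ.* (x ℕ.+ y))    ∎
  where open ≡-Reasoning

n<AB[A+B] : ∀ n → + n < A (+ n) * B (+ n) * (A (+ n) + B (+ n))
n<AB[A+B] n = subst (+ n <_) (sym AB[A+B]-on-ℕ) (+<+ (begin-strict
  n                      ≤⟨ ℕ.m≤n*m n 364 ⟩
  364 ℕ.* n              <⟨ ℕ.n<1+n _ ⟩
  1 ℕ.+ 364 ℕ.* n        ≤⟨ ℕ.m≤m*n _ (11 ℕ.+ 5460 ℕ.* n) ⟩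
  X                      ≤⟨ ℕ.m≤m*n X Y ⟩
  X ℕ.* Y                ≤⟨ ℕ.m≤m*n (X ℕ.* Y) (X ℕ.+ Y) ⟩
  X ℕ.* Y ℕ.* (X ℕ.+ Y)  ∎))
  where
  open ℕ.≤-Reasoning
  X Y : ℕ
  X = (1 ℕ.+ 364 ℕ.* n) ℕ.* (11 ℕ.+ 5460 ℕ.* n)
  Y = 16 ℕ.* ((19 ℕ.+ 1092 ℕ.* n) ℕ.* (21 ℕ.+ 1820 ℕ.* n))
  AB[A+B]-on-ℕ : A (+ n) * B (+ n) * (A (+ n) + B (+ n)) ≡ + (X ℕ.* Y ℕ.* (X ℕ.+ Y))
  AB[A+B]-on-ℕ = trans (cong₂ (λ x y → x * y * (x + y)) (A-on-ℕ n) (B-on-ℕ n)) (x*y*[x+y]-on-ℕ X Y)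

AB[A+B]-unbounded : ∀ M → ∃[ T ] (∀ t → T ≤ t → M < A t * B t * (A t + B t))
AB[A+B]-unbounded M = M ⊔ + 0 , λ t T≤t →
  ℤ.≤-<-trans (ℤ.≤-trans (ℤ.i≤i⊔j M (+ 0)) T≤t) (t<AB[A+B] (ℤ.≤-trans (ℤ.i≤j⊔i M (+ 0)) T≤t))
  where
  t<AB[A+B] : ∀ {t} → + 0 ≤ t → t < A t * B t * (A t + B t)
  t<AB[A+B] (+≤+ {n = n} _) = n<AB[A+B] n

lemma2p2 :
    (∀ (t : ℤ) → + 1 ≤ t →
        (A t * B t * (A t + B t) ≡ A′ t * B′ t * (A′ t + B′ t))
      × (A t * A t + A t * B t + B t * B t ≢ A′ t * A′ t + A′ t * B′ t + B′ t * B′ t)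
      × (Ord2 (B t) 4 × Ord2 (B′ t) 4)
      × ((+ 4 ∣ A t + + 1) × (+ 4 ∣ A′ t + + 1))
      × Coprime (A t) (B t)
      × Coprime (A′ t) (B′ t))
    × (∀ (M : ℤ) → ∃[ T ] (∀ (t : ℤ) → T ≤ t → M < A t * B t * (A t + B t)))
lemma2p2 = (λ t _ →
      A-B-identity (aₜ t) (bₜ t)
    , norm-A-B≢norm-A′-B′ (aₜ≡1[mod7] t) (bₜ≡5[mod7] t)
    , (B-ord₂ (aₜ-odd t) (bₜ-odd t) , B′-ord₂ (aₜ-odd t) (bₜ-odd t))
    , (4∣A+1 (aₜ≡1[mod4] t) (bₜ≡1[mod4] t) , 4∣A′+1 (aₜ≡1[mod4] t) (bₜ≡1[mod4] t))
    , A⊥B (aₜ-odd t) (bₜ-odd t) (aₜ⊥bₜ t) (cₜ⊥4095 t)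
    , A′⊥B′ (aₜ-odd t) (bₜ-odd t) (aₜ⊥bₜ t) (cₜ⊥4095 t))
  , AB[A+B]-unbounded
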